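{- The set of flat formulas of $\mathbf{PT}$ is closed under flat substitutions: if $\phi$ is a flat formula of $\mathbf{PT}$ and $\sigma$ is a flat substitution, then $\sigma(\phi)$ is flat.
   Context: A valuation is a function $v:\mathrm{Prop}\to\{0,1\}$; a team is a set of valuations. Formulas of $\mathbf{PT}$: $\phi::=p\mid\bot\mid\top\mid {=}(\phi,\dots,\phi,\phi)\mid\neg\phi\mid\phi\wedge\phi\mid\phi\otimes\phi\mid\phi\vee\phi\mid\phi\to\phi$. Team semantics: $X\models p$ iff $v(p)=1$ for all $v\in X$; $X\models\bot$ iff $X=\emptyset$; $X\models\top$ always; $X\models\phi\wedge\psi$ iff both; $X\models\phi\otimes\psi$ iff $X=Y\cup Z$ for some $Y,Z\subseteq X$ with $Y\models\phi$, $Z\models\psi$; $X\models\phi\vee\psi$ iff $X\models\phi$ or $X\models\psi$; $X\models\phi\to\psi$ iff every $Y\subseteq X$ with $Y\models\phi$ satisfies $Y\models\psi$; $X\models\neg\phi$ iff $\{v\}\not\models\phi$ for all $v\in X$; $X\models{=}(\phi_1,\dots,\phi_n,\psi)$ iff $X\models\bigwedge_{i=1}^n(\phi_i\vee\neg\phi_i)\to(\psi\vee\neg\psi)$. A formula $\phi$ is flat if for every team $X$: $X\models\phi$ iff $\{v\}\models\phi$ for all $v\in X$. A substitution is a map on $\mathbf{PT}$-formulas commuting with all connectives and atoms; it is flat if $\sigma(p)$ is flat for every propositional variable $p$. -}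

module Defs where

open import Level using (Lift; lift) renaming (suc to lsuc; zero to lzero)
open import Data.Nat using (ℕ)
open import Data.Bool using (Bool; true)
open import Data.List using (List; []; _∷_)
open import Data.Product using (Σ; _×_; _,_)
open import Data.Sum using (_⊎_)
open import Data.Empty using (⊥)
open import Data.Unit using (⊤)
open import Relation.Nullary using (¬_)
open import Relation.Binary.PropositionalEquality using (_≡_)

Prop : Set
Prop = ℕ

Valuation : Set
Valuation = Prop → Bool

Team : Set₁
Team = Valuation → Set

_⊆_ : Team → Team → Set
Y ⊆ X = ∀ v → Y v → X v

⟦_⟧ : Valuation → Team
⟦ v ⟧ w = w ≡ v

-- Formulas of PT.  dep φs ψ is the dependence atom =(φ₁,…,φₙ,ψ).
data Formula : Set where
  var  : Prop → Formula
  bot  : Formula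
  top  : Formula
  dep  : List Formula → Formula → Formula
  neg  : Formula → Formula
  _∧_  : Formula → Formula → Formula
  _⊗_  : Formula → Formula → Formula
  _∨_  : Formula → Formula → Formula
  _⇒_  : Formula → Formula → Formula

mutual
  _⊨_ : Team → Formula → Set₁
  X ⊨ var p = Lift _ (∀ v → X v → v p ≡ true)
  X ⊨ bot = Lift _ (∀ v → ¬ X v)
  X ⊨ top = Lift _ ⊤
  X ⊨ dep φs ψ =
    ∀ (Y : Team) → Y ⊆ X → (Y ⊨⋀det φs) → ((Y ⊨ ψ) ⊎ (∀ v → Y v → ¬ (⟦ v ⟧ ⊨ ψ)))
  X ⊨ neg φ = ∀ v → X v → ¬ (⟦ v ⟧ ⊨ φ)
  X ⊨ (φ ∧ ψ) = (X ⊨ φ) × (X ⊨ ψ)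
  X ⊨ (φ ⊗ ψ) =
    Σ Team λ Y → Σ Team λ Z →
      (Y ⊆ X) × (Z ⊆ X) × (∀ v → X v → Y v ⊎ Z v) × (Y ⊨ φ) × (Z ⊨ ψ)
  X ⊨ (φ ∨ ψ) = (X ⊨ φ) ⊎ (X ⊨ ψ)
  X ⊨ (φ ⇒ ψ) = ∀ (Y : Team) → Y ⊆ X → Y ⊨ φ → Y ⊨ ψ

  -- X ⊨ ⋀ᵢ (φᵢ ∨ ¬φᵢ)  (¬ clause inlined for termination)   (empty conjunction = ⊤)
  _⊨⋀det_ : Team → List Formula → Set₁
  X ⊨⋀det [] = Lift _ ⊤
  X ⊨⋀det (φ ∷ φs) = ((X ⊨ φ) ⊎ (∀ v → X v → ¬ (⟦ v ⟧ ⊨ φ))) × (X ⊨⋀det φs)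

Flat : Formula → Set₁
Flat φ = ∀ (X : Team) → ((X ⊨ φ) → (∀ v → X v → ⟦ v ⟧ ⊨ φ))
                      × ((∀ v → X v → ⟦ v ⟧ ⊨ φ) → (X ⊨ φ))

Substitution : Set
Substitution = Prop → Formula

mutual
  subst : Substitution → Formula → Formula
  subst σ (var p) = σ p
  subst σ bot = bot
  subst σ top = top
  subst σ (dep φs ψ) = dep (substs σ φs) (subst σ ψ)
  subst σ (neg φ) = neg (subst σ φ)
  subst σ (φ ∧ ψ) = subst σ φ ∧ subst σ ψ
  subst σ (φ ⊗ ψ) = subst σ φ ⊗ subst σ ψ
  subst σ (φ ∨ ψ) = subst σ φ ∨ subst σ ψ
  subst σ (φ ⇒ ψ) = subst σ φ ⇒ subst σ ψ

  substs : Substitution → List Formula → List Formula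
  substs σ [] = []
  substs σ (φ ∷ φs) = subst σ φ ∷ substs σ φs

FlatSubstitution : Substitution → Set₁
FlatSubstitution σ = ∀ p → Flat (σ p)

-- Every formula is downward closed, so one direction of flatness is free.  For the
-- other, a flat substitution σ induces a map f on valuations, f v p = [{v} ⊨ σ p],
-- and X ⊨ σ ψ holds iff f[X] ⊨ ψ, for every ψ (by induction on ψ, with flatness of
-- σ p used at the variables).  So if every {v} ⊆ X satisfies σ φ, every {f v}
-- satisfies φ, hence f[X] ⊨ φ by flatness of φ, and therefore X ⊨ σ φ.
module Submission where

open import Defs
open import Level using (lift; lower)
open import Data.Bool using (true; false)
open import Data.List using ([]; _∷_)
open import Data.Product using (Σ; _×_; _,_; proj₁; proj₂)
open import Data.Sum using (_⊎_; inj₁; inj₂; [_,_]) renaming (map to ⊎-map)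
open import Data.Empty using (⊥; ⊥-elim)
open import Data.Unit using (tt)
open import Function.Bundles using (_⇔_; mk⇔; Equivalence)
open import Relation.Nullary using (¬_; Dec; yes; no; does)
open import Relation.Binary.PropositionalEquality using (_≡_; refl; sym; trans; cong)

⊆-refl : ∀ {X : Team} → X ⊆ X
⊆-refl _ x = x

⊆-trans : ∀ {X Y Z : Team} → X ⊆ Y → Y ⊆ Z → X ⊆ Z
⊆-trans s t v x = t v (s v x)

∅ : Team
∅ _ = ⊥

Empty : Team → Set
Empty X = ∀ v → ¬ X v

empty-⊨ : ∀ ψ {X : Team} → Empty X → X ⊨ ψ
empty-⊨ (var p) e = lift λ v x → ⊥-elim (e v x)
empty-⊨ bot e = lift e
empty-⊨ top e = lift tt
empty-⊨ (dep φs ψ) e = λ Y s _ → inj₂ λ v y → ⊥-elim (e v (s v y))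
empty-⊨ (neg ψ) e = λ v x → ⊥-elim (e v x)
empty-⊨ (a ∧ b) e = empty-⊨ a e , empty-⊨ b e
empty-⊨ (a ⊗ b) {X} e = X , X , ⊆-refl , ⊆-refl , (λ _ → inj₁) , empty-⊨ a e , empty-⊨ b e
empty-⊨ (a ∨ b) e = inj₁ (empty-⊨ a e)
empty-⊨ (a ⇒ b) e = λ Y s _ → empty-⊨ b λ v y → e v (s v y)

⊨-downClosed : ∀ ψ {X Y : Team} → Y ⊆ X → X ⊨ ψ → Y ⊨ ψ
⊨-downClosed (var p) s h = lift λ v y → lower h v (s v y)
⊨-downClosed bot s h = lift λ v y → lower h v (s v y)
⊨-downClosed top s h = lift tt
⊨-downClosed (dep φs ψ) s h = λ Y' s' → h Y' (⊆-trans s' s)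
⊨-downClosed (neg ψ) s h = λ v y → h v (s v y)
⊨-downClosed (a ∧ b) s (ha , hb) = ⊨-downClosed a s ha , ⊨-downClosed b s hb
⊨-downClosed (a ⊗ b) {Y = Y} s (Y₁ , Z₁ , s₁ , s₂ , cover , ha , hb) =
  (λ v → Y v × Y₁ v) , (λ v → Y v × Z₁ v) , (λ _ → proj₁) , (λ _ → proj₁)
  , (λ v y → ⊎-map (y ,_) (y ,_) (cover v (s v y)))
  , ⊨-downClosed a (λ _ → proj₂) ha , ⊨-downClosed b (λ _ → proj₂) hb
⊨-downClosed (a ∨ b) s (inj₁ h) = inj₁ (⊨-downClosed a s h)
⊨-downClosed (a ∨ b) s (inj₂ h) = inj₂ (⊨-downClosed b s h)
⊨-downClosed (a ⇒ b) s h = λ Y' s' → h Y' (⊆-trans s' s)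

⊨⇒singletons-⊨ : ∀ ψ {X : Team} → X ⊨ ψ → ∀ v → X v → ⟦ v ⟧ ⊨ ψ
⊨⇒singletons-⊨ ψ h v x = ⊨-downClosed ψ (λ { _ refl → x }) h

-- Constructively a subteam of {v} need not be decidably ∅ or {v}, so deciding
-- {v} ⊨ ψ by induction on ψ requires this stronger dichotomy over all its subteams.
HoldsAt : Formula → Valuation → Set₁
HoldsAt ψ v = ∀ (Y : Team) → Y ⊆ ⟦ v ⟧ → Y ⊨ ψ

FailsAt : Formula → Valuation → Set₁
FailsAt ψ v = ∀ (Y : Team) → Y ⊆ ⟦ v ⟧ → Y ⊨ ψ → ¬ Y v

module _ {ψ : Formula} {v : Valuation} where

  HoldsAt⇒⊨ : HoldsAt ψ v → ⟦ v ⟧ ⊨ ψ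
  HoldsAt⇒⊨ f = f ⟦ v ⟧ ⊆-refl

  FailsAt⇒⊭ : FailsAt ψ v → ¬ (⟦ v ⟧ ⊨ ψ)
  FailsAt⇒⊭ e h = e ⟦ v ⟧ ⊆-refl h refl

  FailsAt⇒empty : FailsAt ψ v → ∀ {Y : Team} → Y ⊆ ⟦ v ⟧ → Y ⊨ ψ → Empty Y
  FailsAt⇒empty e {Y} s h u y with s u y
  ... | refl = e Y s h y

  FailsAt⇒⊨neg : FailsAt ψ v → ∀ {Y : Team} → Y ⊆ ⟦ v ⟧ → Y ⊨ neg ψ
  FailsAt⇒⊨neg e s u y with s u y
  ... | refl = FailsAt⇒⊭ e

holdsAt-or-failsAt : ∀ ψ v → HoldsAt ψ v ⊎ FailsAt ψ v
holdsAt-or-failsAt (var p) v with v p in vp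
... | true  = inj₁ λ Y s → lift λ u y → trans (cong (λ w → w p) (s u y)) vp
... | false = inj₂ λ Y s h y → true≢false (trans (sym (lower h v y)) vp)
  where
  true≢false : true ≡ false → ⊥
  true≢false ()
holdsAt-or-failsAt bot v = inj₂ λ Y s h → lower h v
holdsAt-or-failsAt top v = inj₁ λ Y s → lift tt
holdsAt-or-failsAt (dep φs ψ) v = inj₁ λ Y s Y' s' _ →
  [ (λ f → inj₁ (f Y' (⊆-trans s' s))) , (λ e → inj₂ (FailsAt⇒⊨neg e (⊆-trans s' s))) ]
    (holdsAt-or-failsAt ψ v)
holdsAt-or-failsAt (neg ψ) v with holdsAt-or-failsAt ψ v
... | inj₁ f = inj₂ λ Y s h y → h v y (HoldsAt⇒⊨ f)
... | inj₂ e = inj₁ λ Y → FailsAt⇒⊨neg e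
holdsAt-or-failsAt (a ∧ b) v with holdsAt-or-failsAt a v | holdsAt-or-failsAt b v
... | inj₁ fa | inj₁ fb = inj₁ λ Y s → fa Y s , fb Y s
... | inj₂ ea | _       = inj₂ λ Y s h → ea Y s (proj₁ h)
... | inj₁ _  | inj₂ eb = inj₂ λ Y s h → eb Y s (proj₂ h)
holdsAt-or-failsAt (a ∨ b) v with holdsAt-or-failsAt a v | holdsAt-or-failsAt b v
... | inj₁ fa | _       = inj₁ λ Y s → inj₁ (fa Y s)
... | inj₂ _  | inj₁ fb = inj₁ λ Y s → inj₂ (fb Y s)
... | inj₂ ea | inj₂ eb = inj₂ λ Y s → [ ea Y s , eb Y s ]
holdsAt-or-failsAt (a ⊗ b) v with holdsAt-or-failsAt a v | holdsAt-or-failsAt b v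
... | inj₁ fa | _       = inj₁ λ Y s →
  Y , ∅ , ⊆-refl , (λ _ ()) , (λ _ → inj₁) , fa Y s , empty-⊨ b (λ _ ())
... | inj₂ _  | inj₁ fb = inj₁ λ Y s →
  ∅ , Y , (λ _ ()) , ⊆-refl , (λ _ → inj₂) , empty-⊨ a (λ _ ()) , fb Y s
... | inj₂ ea | inj₂ eb = inj₂ λ { Y s (Y₁ , Z₁ , s₁ , s₂ , cover , ha , hb) y →
  [ ea Y₁ (⊆-trans s₁ s) ha , eb Z₁ (⊆-trans s₂ s) hb ] (cover v y) }
holdsAt-or-failsAt (a ⇒ b) v with holdsAt-or-failsAt a v | holdsAt-or-failsAt b v
... | _       | inj₁ fb = inj₁ λ Y s Y' s' _ → fb Y' (⊆-trans s' s)
... | inj₂ ea | inj₂ _  = inj₁ λ Y s Y' s' ha →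
  empty-⊨ b (FailsAt⇒empty ea (⊆-trans s' s) ha)
... | inj₁ fa | inj₂ eb = inj₂ λ Y s h → eb Y s (h Y ⊆-refl (fa Y s))

⊨-singleton? : ∀ ψ v → Dec (⟦ v ⟧ ⊨ ψ)
⊨-singleton? ψ v with holdsAt-or-failsAt ψ v
... | inj₁ f = yes (HoldsAt⇒⊨ f)
... | inj₂ e = no (FailsAt⇒⊭ e)

record EgliMilner (R : Valuation → Valuation → Set) (X X' : Team) : Set where
  field
    forth : ∀ v → X v → Σ Valuation λ w → X' w × R v w
    back  : ∀ w → X' w → Σ Valuation λ v → X v × R v w

module _ {R : Valuation → Valuation → Set} where

  EgliMilner-singleton : ∀ {v w} → R v w → EgliMilner R ⟦ v ⟧ ⟦ w ⟧
  EgliMilner-singleton {v} {w} r = record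
    { forth = λ { _ refl → w , refl , r }
    ; back  = λ { _ refl → v , refl , r } }

  restrictˡ : Team → Team → Team
  restrictˡ Y X' w = X' w × Σ Valuation λ v → Y v × R v w

  restrictʳ : Team → Team → Team
  restrictʳ X Y' v = X v × Σ Valuation λ w → Y' w × R v w

  EgliMilner-restrictˡ : ∀ {X X' Y} → EgliMilner R X X' → Y ⊆ X → EgliMilner R Y (restrictˡ Y X')
  EgliMilner-restrictˡ rel s = record
    { forth = λ v y → let (w , x' , r) = forth v (s v y) in w , (x' , v , y , r) , r
    ; back  = λ w → proj₂ }
    where open EgliMilner rel

  EgliMilner-restrictʳ : ∀ {X X' Y'} → EgliMilner R X X' → Y' ⊆ X' → EgliMilner R (restrictʳ X Y') Y'
  EgliMilner-restrictʳ rel s = record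
    { forth = λ v → proj₂
    ; back  = λ w y' → let (v , x , r) = back w (s w y') in v , (x , w , y' , r) , r }
    where open EgliMilner rel

module Transfer (σ : Substitution) (σ-flat : FlatSubstitution σ)
  (R : Valuation → Valuation → Set)
  (R-atoms : ∀ {v w} → R v w → ∀ p → (⟦ v ⟧ ⊨ σ p) ⇔ (w p ≡ true)) where

  open EgliMilner

  mutual
    ⊨subst⇒⊨ : ∀ ψ {X X'} → EgliMilner R X X' → X ⊨ subst σ ψ → X' ⊨ ψ
    ⊨subst⇒⊨ (var p) rel h = lift λ w x' → let (v , x , r) = back rel w x' in
      Equivalence.to (R-atoms r p) (proj₁ (σ-flat p _) h v x)
    ⊨subst⇒⊨ bot rel h = lift λ w x' → let (v , x , _) = back rel w x' in lower h v x
    ⊨subst⇒⊨ top rel h = lift tt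
    ⊨subst⇒⊨ (dep φs ψ) rel h = λ Y' s d → let rel' = EgliMilner-restrictʳ rel s in
      ⊨subst⇒⊨-excluded-middle ψ rel' (h _ (λ _ → proj₁) (⊨⇒⊨subst-⋀det φs rel' d))
    ⊨subst⇒⊨ (neg ψ) rel h = ⊨subst⇒⊨-neg ψ rel h
    ⊨subst⇒⊨ (a ∧ b) rel (ha , hb) = ⊨subst⇒⊨ a rel ha , ⊨subst⇒⊨ b rel hb
    ⊨subst⇒⊨ (a ⊗ b) rel (Y , Z , sY , sZ , cover , ha , hb) =
      restrictˡ Y _ , restrictˡ Z _ , (λ _ → proj₁) , (λ _ → proj₁)
      , (λ w x' → let (v , x , r) = back rel w x' in
           ⊎-map (λ y → x' , v , y , r) (λ z → x' , v , z , r) (cover v x))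
      , ⊨subst⇒⊨ a (EgliMilner-restrictˡ rel sY) ha
      , ⊨subst⇒⊨ b (EgliMilner-restrictˡ rel sZ) hb
    ⊨subst⇒⊨ (a ∨ b) rel (inj₁ h) = inj₁ (⊨subst⇒⊨ a rel h)
    ⊨subst⇒⊨ (a ∨ b) rel (inj₂ h) = inj₂ (⊨subst⇒⊨ b rel h)
    ⊨subst⇒⊨ (a ⇒ b) rel h = λ Y' s ha → let rel' = EgliMilner-restrictʳ rel s in
      ⊨subst⇒⊨ b rel' (h _ (λ _ → proj₁) (⊨⇒⊨subst a rel' ha))

    ⊨⇒⊨subst : ∀ ψ {X X'} → EgliMilner R X X' → X' ⊨ ψ → X ⊨ subst σ ψ
    ⊨⇒⊨subst (var p) rel h = proj₂ (σ-flat p _) λ v x → let (w , x' , r) = forth rel v x in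
      Equivalence.from (R-atoms r p) (lower h w x')
    ⊨⇒⊨subst bot rel h = lift λ v x → let (w , x' , _) = forth rel v x in lower h w x'
    ⊨⇒⊨subst top rel h = lift tt
    ⊨⇒⊨subst (dep φs ψ) rel h = λ Y s d → let rel' = EgliMilner-restrictˡ rel s in
      ⊨⇒⊨subst-excluded-middle ψ rel' (h _ (λ _ → proj₁) (⊨subst⇒⊨-⋀det φs rel' d))
    ⊨⇒⊨subst (neg ψ) rel h = ⊨⇒⊨subst-neg ψ rel h
    ⊨⇒⊨subst (a ∧ b) rel (ha , hb) = ⊨⇒⊨subst a rel ha , ⊨⇒⊨subst b rel hb
    ⊨⇒⊨subst (a ⊗ b) rel (Y' , Z' , sY' , sZ' , cover , ha , hb) =
      restrictʳ _ Y' , restrictʳ _ Z' , (λ _ → proj₁) , (λ _ → proj₁)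
      , (λ v x → let (w , x' , r) = forth rel v x in
           ⊎-map (λ y' → x , w , y' , r) (λ z' → x , w , z' , r) (cover w x'))
      , ⊨⇒⊨subst a (EgliMilner-restrictʳ rel sY') ha
      , ⊨⇒⊨subst b (EgliMilner-restrictʳ rel sZ') hb
    ⊨⇒⊨subst (a ∨ b) rel (inj₁ h) = inj₁ (⊨⇒⊨subst a rel h)
    ⊨⇒⊨subst (a ∨ b) rel (inj₂ h) = inj₂ (⊨⇒⊨subst b rel h)
    ⊨⇒⊨subst (a ⇒ b) rel h = λ Y s ha → let rel' = EgliMilner-restrictˡ rel s in
      ⊨⇒⊨subst b rel' (h _ (λ _ → proj₁) (⊨subst⇒⊨ a rel' ha))

    ⊨subst⇒⊨-neg : ∀ ψ {X X'} → EgliMilner R X X' → X ⊨ subst σ (neg ψ) → X' ⊨ neg ψ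
    ⊨subst⇒⊨-neg ψ rel h w x' hw = let (v , x , r) = back rel w x' in
      h v x (⊨⇒⊨subst ψ (EgliMilner-singleton r) hw)

    ⊨⇒⊨subst-neg : ∀ ψ {X X'} → EgliMilner R X X' → X' ⊨ neg ψ → X ⊨ subst σ (neg ψ)
    ⊨⇒⊨subst-neg ψ rel h v x hv = let (w , x' , r) = forth rel v x in
      h w x' (⊨subst⇒⊨ ψ (EgliMilner-singleton r) hv)

    ⊨subst⇒⊨-excluded-middle : ∀ ψ {X X'} → EgliMilner R X X' →
      X ⊨ subst σ (ψ ∨ neg ψ) → X' ⊨ (ψ ∨ neg ψ)
    ⊨subst⇒⊨-excluded-middle ψ rel = ⊎-map (⊨subst⇒⊨ ψ rel) (⊨subst⇒⊨-neg ψ rel)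

    ⊨⇒⊨subst-excluded-middle : ∀ ψ {X X'} → EgliMilner R X X' →
      X' ⊨ (ψ ∨ neg ψ) → X ⊨ subst σ (ψ ∨ neg ψ)
    ⊨⇒⊨subst-excluded-middle ψ rel = ⊎-map (⊨⇒⊨subst ψ rel) (⊨⇒⊨subst-neg ψ rel)

    ⊨subst⇒⊨-⋀det : ∀ φs {X X'} → EgliMilner R X X' → X ⊨⋀det substs σ φs → X' ⊨⋀det φs
    ⊨subst⇒⊨-⋀det [] rel _ = lift tt
    ⊨subst⇒⊨-⋀det (φ ∷ φs) rel (d , ds) =
      ⊨subst⇒⊨-excluded-middle φ rel d , ⊨subst⇒⊨-⋀det φs rel ds

    ⊨⇒⊨subst-⋀det : ∀ φs {X X'} → EgliMilner R X X' → X' ⊨⋀det φs → X ⊨⋀det substs σ φs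
    ⊨⇒⊨subst-⋀det [] rel _ = lift tt
    ⊨⇒⊨subst-⋀det (φ ∷ φs) rel (d , ds) =
      ⊨⇒⊨subst-excluded-middle φ rel d , ⊨⇒⊨subst-⋀det φs rel ds

induced : Substitution → Valuation → Valuation
induced σ v p = does (⊨-singleton? (σ p) v)

induced-atoms : ∀ σ {v w} → w ≡ induced σ v → ∀ p → (⟦ v ⟧ ⊨ σ p) ⇔ (w p ≡ true)
induced-atoms σ {v} refl p with ⊨-singleton? (σ p) v
... | yes h = mk⇔ (λ _ → refl) (λ _ → h)
... | no ¬h = mk⇔ (λ h → ⊥-elim (¬h h)) (λ ())

image : (Valuation → Valuation) → Team → Team
image f X w = Σ Valuation λ v → X v × w ≡ f v

EgliMilner-image : ∀ f (X : Team) → EgliMilner (λ v w → w ≡ f v) X (image f X)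
EgliMilner-image f X = record { forth = λ v x → f v , (v , x , refl) , refl ; back = λ _ y → y }

lemma3p6 : (φ : Formula) (σ : Substitution) → Flat φ → FlatSubstitution σ → Flat (subst σ φ)
lemma3p6 φ σ φ-flat σ-flat X = ⊨⇒singletons-⊨ (subst σ φ) , singletons-⊨⇒⊨
  where
  open Transfer σ σ-flat (λ v w → w ≡ induced σ v) (induced-atoms σ)

  singletons-⊨⇒⊨ : (∀ v → X v → ⟦ v ⟧ ⊨ subst σ φ) → X ⊨ subst σ φ
  singletons-⊨⇒⊨ H = ⊨⇒⊨subst φ (EgliMilner-image (induced σ) X)
    (proj₂ (φ-flat (image (induced σ) X)) λ { _ (v , x , refl) →
      ⊨subst⇒⊨ φ (EgliMilner-singleton refl) (H v x) })
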